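{- For every integer $n\geq 3$, $N(C_n)=bc(K_{n,n}\setminus C_{2n})$.
   Context: $C_n$ is the cycle on $n$ vertices; $K_{n,n}\setminus C_{2n}$ is the complete bipartite graph $K_{n,n}$ with the edges of a Hamiltonian cycle (a cycle of length $2n$) removed. For a graph $G$, a covering of $G$ is a collection of subsets $A_1,\ldots,A_n$ of $V(G)$ such that for every edge $\{u,v\}$ and every vertex $x\notin\{u,v\}$ there is some $A_j$ with $\{u,v\}\subseteq A_j$ and $x\notin A_j$; $N(G)$ is the minimum size of a covering. A biclique is a complete bipartite subgraph; $bc(H)$ is the smallest number of bicliques of $H$ whose union contains every edge of $H$. -}

module Defs where

open import Data.Nat using (ℕ; zero; suc; _<_)
open import Data.Fin using (Fin; toℕ)
open import Data.Bool using (Bool; true; false)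
open import Data.Sum using (_⊎_; inj₁; inj₂)
open import Data.Product using (_×_; ∃-syntax; Σ-syntax)
open import Data.Empty using (⊥)
open import Relation.Nullary using (¬_)
open import Relation.Binary.PropositionalEquality using (_≡_; _≢_)

-- A (simple, undirected) graph is given by a vertex type V and a symmetric
-- adjacency relation E : V → V → Set.  Subsets of V are characteristic
-- functions V → Bool.

IsCovering : {V : Set} → (V → V → Set) → (k : ℕ) → (Fin k → V → Bool) → Set
IsCovering {V} E k A =
  ∀ (u v : V) → E u v → ∀ (x : V) → x ≢ u → x ≢ v →
  ∃[ j ] (A j u ≡ true × A j v ≡ true × A j x ≡ false)

IsN : {V : Set} → (V → V → Set) → ℕ → Set
IsN {V} E k =
  (Σ[ A ∈ (Fin k → V → Bool) ] IsCovering E k A) ×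
  (∀ k′ → k′ < k → ¬ (Σ[ A ∈ (Fin k′ → V → Bool) ] IsCovering E k′ A))

IsBiclique : {V : Set} → (V → V → Set) → (V → Bool) → (V → Bool) → Set
IsBiclique {V} E X Y =
  (∀ (v : V) → X v ≡ true → Y v ≡ false) ×
  (∀ (x y : V) → X x ≡ true → Y y ≡ true → E x y)

IsBicliqueCover : {V : Set} → (V → V → Set) → (k : ℕ) →
                  (Fin k → V → Bool) → (Fin k → V → Bool) → Set
IsBicliqueCover {V} E k X Y =
  (∀ j → IsBiclique E (X j) (Y j)) ×
  (∀ (u v : V) → E u v →
     ∃[ j ] ((X j u ≡ true × Y j v ≡ true) ⊎ (X j v ≡ true × Y j u ≡ true)))

IsBC : {V : Set} → (V → V → Set) → ℕ → Set
IsBC {V} E k =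
  (Σ[ X ∈ (Fin k → V → Bool) ] Σ[ Y ∈ (Fin k → V → Bool) ] IsBicliqueCover E k X Y) ×
  (∀ k′ → k′ < k →
     ¬ (Σ[ X ∈ (Fin k′ → V → Bool) ] Σ[ Y ∈ (Fin k′ → V → Bool) ] IsBicliqueCover E k′ X Y))

SuccMod : (n : ℕ) → Fin n → Fin n → Set
SuccMod n i j = (toℕ j ≡ suc (toℕ i)) ⊎ (suc (toℕ i) ≡ n × toℕ j ≡ 0)

CycleAdj : (n : ℕ) → Fin n → Fin n → Set
CycleAdj n u v = SuccMod n u v ⊎ SuccMod n v u

-- Vertices: inj₁ i = a_i (left), inj₂ j = b_j (right).
-- The removed Hamiltonian cycle is a_0 b_0 a_1 b_1 … a_{n-1} b_{n-1} a_0,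
-- i.e. the removed edges are {a_j, b_j} and {a_{j+1 mod n}, b_j}.

LRAdj : (n : ℕ) → Fin n → Fin n → Set
LRAdj n i j = ¬ (i ≡ j) × ¬ SuccMod n j i

KnnMinusC2nAdj : (n : ℕ) → (Fin n ⊎ Fin n) → (Fin n ⊎ Fin n) → Set
KnnMinusC2nAdj n (inj₁ i) (inj₁ i′) = ⊥
KnnMinusC2nAdj n (inj₁ i) (inj₂ j)  = LRAdj n i j
KnnMinusC2nAdj n (inj₂ j) (inj₁ i)  = LRAdj n i j
KnnMinusC2nAdj n (inj₂ j) (inj₂ j′) = ⊥

-- The sets of a covering of G and the bicliques of the vertex/edge non-incidence
-- graph H(G) correspond one to one.  A set A yields the biclique with sides
-- "vertices outside A" and "edges inside A": a vertex x and an edge uv lie in it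
-- exactly when A separates uv from x, which is what coverings ask for.  Conversely
-- a biclique spanning x and the edge uv leaves u and v outside both of its sides
-- (neither is adjacent to uv), so the vertices outside the biclique form a set
-- separating uv from x.  Both translations keep the number of sets, so the least
-- sizes agree.  Indexing the edge {i, i+1 mod n} of C_n by i makes H(C_n) exactly
-- K_{n,n} ∖ C_{2n}.
module Submission where

open import Defs
open import Data.Nat using (ℕ; _≤_)
open import Function.Bundles using (_⇔_)

open import Data.Nat using (suc; _<_; _<?_)
open import Data.Nat.Properties using (≤-antisym; <-irrefl; ≮⇒≥)
open import Data.Fin using (Fin; toℕ; fromℕ<)
open import Data.Fin.Properties using (toℕ-fromℕ<; toℕ-injective; toℕ<n)
open import Data.Bool using (Bool; true; false; not; _∧_; _∨_)
open import Data.Bool.Properties using (not-injective; not-¬; ¬-not; ∧-conicalˡ; ∧-conicalʳ; ∨-zeroʳ)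
open import Data.Sum using (_⊎_; inj₁; inj₂)
open import Data.Product using (_×_; _,_; proj₁; proj₂; uncurry; ∃-syntax; Σ-syntax)
open import Data.Empty using (⊥; ⊥-elim)
open import Relation.Nullary using (¬_; yes; no)
open import Relation.Binary.Definitions using (Symmetric)
open import Relation.Binary.PropositionalEquality
open import Function.Base using (id)
open import Function.Bundles using (mk⇔; Equivalence)
open import Function.Properties.Equivalence using () renaming (refl to ⇔-refl; sym to ⇔-sym; trans to ⇔-trans)
open import Function.Related.TypeIsomorphisms using (¬-cong-⇔)
open import Data.Product.Function.NonDependent.Propositional using (_×-⇔_)

IsLeast : (ℕ → Set) → ℕ → Set
IsLeast P k = P k × (∀ k′ → k′ < k → ¬ P k′)

IsLeast-⇔ : {P Q : ℕ → Set} → (∀ k → P k ⇔ Q k) → ∀ k → IsLeast P k ⇔ IsLeast Q k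
IsLeast-⇔ P⇔Q k = mk⇔
  (λ (p , least) → to (P⇔Q k) p , λ k′ k′<k q → least k′ k′<k (from (P⇔Q k′) q))
  (λ (q , least) → from (P⇔Q k) q , λ k′ k′<k p → least k′ k′<k (to (P⇔Q k′) p))
  where open Equivalence

module _ {V : Set} where

  HasCovering : (V → V → Set) → ℕ → Set
  HasCovering E k = Σ[ A ∈ (Fin k → V → Bool) ] IsCovering E k A

  HasBicliqueCover : (V → V → Set) → ℕ → Set
  HasBicliqueCover E k =
    Σ[ X ∈ (Fin k → V → Bool) ] Σ[ Y ∈ (Fin k → V → Bool) ] IsBicliqueCover E k X Y

  Spans : (V → Bool) → (V → Bool) → V → V → Set
  Spans X Y a b = (X a ≡ true × Y b ≡ true) ⊎ (X b ≡ true × Y a ≡ true)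

  Spans-inside : {X Y : V → Bool} {a b : V} → Spans X Y a b → X a ≡ true ⊎ Y a ≡ true
  Spans-inside (inj₁ (Xa , _)) = inj₁ Xa
  Spans-inside (inj₂ (_ , Ya)) = inj₂ Ya

  outside-biclique : {E : V → V → Set} → Symmetric E → {X Y : V → Bool} {a b w : V} →
                     IsBiclique E X Y → Spans X Y a b → ¬ E w a → ¬ E w b →
                     X w ≡ false × Y w ≡ false
  outside-biclique {E} E-sym {X} {Y} {a} {b} {w} (_ , complete) spans ¬wa ¬wb =
    ¬-not (¬X spans) , ¬-not (¬Y spans)
    where
    ¬X : Spans X Y a b → ¬ X w ≡ true
    ¬X (inj₁ (_ , Yb)) Xw = ¬wb (complete w b Xw Yb)
    ¬X (inj₂ (_ , Ya)) Xw = ¬wa (complete w a Xw Ya)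
    ¬Y : Spans X Y a b → ¬ Y w ≡ true
    ¬Y (inj₁ (Xa , _)) Yw = ¬wa (E-sym (complete a w Xa Yw))
    ¬Y (inj₂ (Xb , _)) Yw = ¬wb (E-sym (complete b w Xb Yw))

  HasBicliqueCover-⇔ : {E E′ : V → V → Set} → (∀ u v → E u v ⇔ E′ u v) →
                       ∀ k → HasBicliqueCover E k ⇔ HasBicliqueCover E′ k
  HasBicliqueCover-⇔ E⇔E′ k = mk⇔ (transport E⇔E′) (transport (λ u v → ⇔-sym (E⇔E′ u v)))
    where
    open Equivalence
    transport : {E E′ : V → V → Set} → (∀ u v → E u v ⇔ E′ u v) →
                HasBicliqueCover E k → HasBicliqueCover E′ k
    transport E⇔E′ (X , Y , bicliques , covers) =
      X , Y , (λ j → proj₁ (bicliques j) , λ x y Xx Yy → to (E⇔E′ x y) (proj₂ (bicliques j) x y Xx Yy))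
            , (λ u v uv → covers u v (from (E⇔E′ u v) uv))

module _ {V Ed : Set} (src tgt : Ed → V) where

  NonIncidence : V ⊎ Ed → V ⊎ Ed → Set
  NonIncidence (inj₁ x) (inj₂ e) = x ≢ src e × x ≢ tgt e
  NonIncidence (inj₂ e) (inj₁ x) = x ≢ src e × x ≢ tgt e
  NonIncidence (inj₁ _) (inj₁ _) = ⊥
  NonIncidence (inj₂ _) (inj₂ _) = ⊥

  NonIncidence-sym : Symmetric NonIncidence
  NonIncidence-sym {inj₁ _} {inj₂ _} x∉e = x∉e
  NonIncidence-sym {inj₂ _} {inj₁ _} x∉e = x∉e

  Joins : Ed → V → V → Set
  Joins e u v = (src e ≡ u × tgt e ≡ v) ⊎ (src e ≡ v × tgt e ≡ u)

  module _ (E : V → V → Set)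
           (joins-adjacent : ∀ e → E (src e) (tgt e))
           (adjacent-joined : ∀ u v → E u v → ∃[ e ] Joins e u v) where

    covering⇒bicliqueCover : ∀ k → HasCovering E k → HasBicliqueCover NonIncidence k
    covering⇒bicliqueCover k (A , separates) = X , Y , biclique , covers
      where
      X Y : Fin k → V ⊎ Ed → Bool
      X j (inj₁ x) = not (A j x)
      X j (inj₂ _) = false
      Y j (inj₁ _) = false
      Y j (inj₂ e) = A j (src e) ∧ A j (tgt e)

      biclique : ∀ j → IsBiclique NonIncidence (X j) (Y j)
      biclique j = disjoint , complete
        where
        disjoint : ∀ v → X j v ≡ true → Y j v ≡ false
        disjoint (inj₁ _) _ = refl
        complete : ∀ a b → X j a ≡ true → Y j b ≡ true → NonIncidence a b
        complete (inj₁ x) (inj₂ e) Xx Ye =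
          (λ { refl → x∉A (∧-conicalˡ _ _ Ye) }) , (λ { refl → x∉A (∧-conicalʳ _ _ Ye) })
          where
          x∉A : A j x ≢ true
          x∉A = not-¬ (not-injective Xx)

      covers : ∀ a b → NonIncidence a b → ∃[ j ] Spans (X j) (Y j) a b
      covers (inj₁ x) (inj₂ e) (x≢s , x≢t) with separates _ _ (joins-adjacent e) x x≢s x≢t
      ... | j , As , At , Ax = j , inj₁ (cong not Ax , cong₂ _∧_ As At)
      covers (inj₂ e) (inj₁ x) (x≢s , x≢t) with separates _ _ (joins-adjacent e) x x≢s x≢t
      ... | j , As , At , Ax = j , inj₂ (cong not Ax , cong₂ _∧_ As At)

    bicliqueCover⇒covering : ∀ k → HasBicliqueCover NonIncidence k → HasCovering E k
    bicliqueCover⇒covering k (X , Y , bicliques , covers) = A , separates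
      where
      A : Fin k → V → Bool
      A j x = not (X j (inj₁ x) ∨ Y j (inj₁ x))

      A-outside : ∀ {j w} → X j (inj₁ w) ≡ false → Y j (inj₁ w) ≡ false → A j w ≡ true
      A-outside Xw Yw = cong₂ (λ a b → not (a ∨ b)) Xw Yw

      A-inside : ∀ {j w} → X j (inj₁ w) ≡ true ⊎ Y j (inj₁ w) ≡ true → A j w ≡ false
      A-inside {j} {w} (inj₁ Xw) = cong (λ a → not (a ∨ Y j (inj₁ w))) Xw
      A-inside {j} {w} (inj₂ Yw) = cong not (trans (cong (X j (inj₁ w) ∨_) Yw) (∨-zeroʳ _))

      separates-endpoints : ∀ e x → x ≢ src e → x ≢ tgt e →
                            ∃[ j ] (A j (src e) ≡ true × A j (tgt e) ≡ true × A j x ≡ false)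
      separates-endpoints e x x≢s x≢t with covers (inj₁ x) (inj₂ e) (x≢s , x≢t)
      ... | j , spans = j , endpoint-outside (λ s∉e → proj₁ s∉e refl) , endpoint-outside (λ t∉e → proj₂ t∉e refl)
                          , A-inside (Spans-inside {X = X j} {Y j} spans)
        where
        endpoint-outside : ∀ {w} → ¬ NonIncidence (inj₁ w) (inj₂ e) → A j w ≡ true
        endpoint-outside ¬we =
          uncurry A-outside (outside-biclique NonIncidence-sym (bicliques j) spans (λ ()) ¬we)

      separates : IsCovering E k A
      separates u v uv x x≢u x≢v with adjacent-joined u v uv
      ... | e , inj₁ (refl , refl) = separates-endpoints e x x≢u x≢v
      ... | e , inj₂ (refl , refl) with separates-endpoints e x x≢v x≢u
      ...   | j , Av , Au , Ax = j , Au , Av , Ax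

    N≡bc-NonIncidence : ∀ k → IsN E k ⇔ IsBC NonIncidence k
    N≡bc-NonIncidence = IsLeast-⇔ (λ k → mk⇔ (covering⇒bicliqueCover k) (bicliqueCover⇒covering k))

suc-mod : {n : ℕ} → Fin n → Fin n
suc-mod {suc m} i with suc (toℕ i) <? suc m
... | yes i+1<n = fromℕ< i+1<n
... | no _ = Fin.zero

SuccMod-suc-mod : {n : ℕ} (i : Fin n) → SuccMod n i (suc-mod i)
SuccMod-suc-mod {suc m} i with suc (toℕ i) <? suc m
... | yes i+1<n = inj₁ (toℕ-fromℕ< i+1<n)
... | no i+1≮n = inj₂ (≤-antisym (toℕ<n i) (≮⇒≥ i+1≮n) , refl)

SuccMod-functional : {n : ℕ} {i j j′ : Fin n} → SuccMod n i j → SuccMod n i j′ → j ≡ j′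
SuccMod-functional {n} {i} {j} {j′} s s′ = toℕ-injective (toℕ-≡ s s′)
  where
  toℕ-≡ : SuccMod n i j → SuccMod n i j′ → toℕ j ≡ toℕ j′
  toℕ-≡ (inj₁ j≡i+1) (inj₁ j′≡i+1) = trans j≡i+1 (sym j′≡i+1)
  toℕ-≡ (inj₁ j≡i+1) (inj₂ (i+1≡n , _)) = ⊥-elim (<-irrefl (trans j≡i+1 i+1≡n) (toℕ<n j))
  toℕ-≡ (inj₂ (i+1≡n , _)) (inj₁ j′≡i+1) = ⊥-elim (<-irrefl (trans j′≡i+1 i+1≡n) (toℕ<n j′))
  toℕ-≡ (inj₂ (_ , j≡0)) (inj₂ (_ , j′≡0)) = trans j≡0 (sym j′≡0)

SuccMod⇔≡suc-mod : {n : ℕ} {i j : Fin n} → SuccMod n i j ⇔ j ≡ suc-mod i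
SuccMod⇔≡suc-mod {i = i} = mk⇔ (λ s → SuccMod-functional s (SuccMod-suc-mod i))
                               (λ { refl → SuccMod-suc-mod i })

CycleAdj-joined : (n : ℕ) → ∀ u v → CycleAdj n u v → ∃[ e ] Joins id suc-mod e u v
CycleAdj-joined n u v (inj₁ u→v) = u , inj₁ (refl , sym (Equivalence.to SuccMod⇔≡suc-mod u→v))
CycleAdj-joined n u v (inj₂ v→u) = v , inj₂ (refl , sym (Equivalence.to SuccMod⇔≡suc-mod v→u))

KnnMinusC2n⇔NonIncidence : (n : ℕ) → ∀ a b → KnnMinusC2nAdj n a b ⇔ NonIncidence id suc-mod a b
KnnMinusC2n⇔NonIncidence n (inj₁ _) (inj₂ _) = ⇔-refl ×-⇔ ¬-cong-⇔ SuccMod⇔≡suc-mod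
KnnMinusC2n⇔NonIncidence n (inj₂ _) (inj₁ _) = ⇔-refl ×-⇔ ¬-cong-⇔ SuccMod⇔≡suc-mod
KnnMinusC2n⇔NonIncidence n (inj₁ _) (inj₁ _) = ⇔-refl
KnnMinusC2n⇔NonIncidence n (inj₂ _) (inj₂ _) = ⇔-refl

-- The hypothesis 3 ≤ n only ensures that C_n is a simple graph; the argument does not need it.
corollary3p6 : (n : ℕ) → 3 ≤ n → (k : ℕ) → IsN (CycleAdj n) k ⇔ IsBC (KnnMinusC2nAdj n) k
corollary3p6 n _ k = ⇔-trans
  (N≡bc-NonIncidence id suc-mod (CycleAdj n) (λ i → inj₁ (SuccMod-suc-mod i)) (CycleAdj-joined n) k)
  (IsLeast-⇔ (HasBicliqueCover-⇔ (λ a b → ⇔-sym (KnnMinusC2n⇔NonIncidence n a b))) k)
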